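{- A convex polyomino $P$ is ascending if and only if for every pair of rows $r_1,r_2$ of $P$ with $r_1$ lying below $r_2$, at least one of $r_1\preceq r_2$, $r_2\preceq r_1$, or $r_1\nearrow r_2$ holds.
   Context: A polyomino is a finite edge-connected set of unit cells; it is convex if every row and column is a contiguous segment of cells. For a row $r$ of $P$, $L(r)$ and $R(r)$ denote the abscissas of its left and right endpoints. For rows $s,t$: $s\preceq t$ (row inclusion) means $L(t)\le L(s)$ and $R(s)\le R(t)$; for $s$ below $t$, $s\nearrow t$ (north-east shift) means $L(s)<L(t)$ and $R(s)<R(t)$. A NW-path inside $P$ is a sequence of cells of $P$, consecutive cells sharing an edge, each step going North or West; write $a\nwarrow b$ if such a path from cell $a$ to cell $b$ exists, let $D_{NW}(a,b)$ be the minimum number of direction changes over such paths, and $D_{NW}(P)=\max\{D_{NW}(a,b):a\nwarrow b\}$. A convex polyomino $P$ is ascending if $D_{NW}(P)\le1$. -}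

module Defs where

open import Data.Integer using (ℤ; _+_; _-_; _≤_; _<_; 1ℤ)
open import Data.Nat using (ℕ; zero; suc) renaming (_≤_ to _≤ℕ_)
open import Data.Product using (_×_; _,_; ∃; ∃-syntax; Σ)
open import Data.Sum using (_⊎_)
open import Data.List using (List; []; _∷_)
open import Data.List.Membership.Propositional using (_∈_)
open import Relation.Binary.PropositionalEquality using (_≡_)
open import Function.Bundles using (_⇔_)

-- A unit cell is identified by its integer coordinates (x , y):
-- x = abscissa (grows to the East), y = ordinate (grows to the North).
Cell : Set
Cell = ℤ × ℤ

data Adjacent : Cell → Cell → Set where
  east  : ∀ x y → Adjacent (x , y) (x + 1ℤ , y)
  west  : ∀ x y → Adjacent (x , y) (x - 1ℤ , y)
  north : ∀ x y → Adjacent (x , y) (x , y + 1ℤ)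
  south : ∀ x y → Adjacent (x , y) (x , y - 1ℤ)

CellSet : Set
CellSet = List Cell

data Connected (S : CellSet) : Cell → Cell → Set where
  here : ∀ {a} → Connected S a a
  step : ∀ {a b c} → Adjacent a b → b ∈ S → Connected S b c → Connected S a c

record Polyomino : Set where
  field
    cells     : CellSet
    nonempty  : ∃[ c ] (c ∈ cells)
    connected : ∀ {a b} → a ∈ cells → b ∈ cells → Connected cells a b
open Polyomino public

Convex : Polyomino → Set
Convex P =
  (∀ x₁ x₂ x y → (x₁ , y) ∈ cells P → (x₂ , y) ∈ cells P →
      x₁ ≤ x → x ≤ x₂ → (x , y) ∈ cells P)
  × (∀ x y₁ y₂ y → (x , y₁) ∈ cells P → (x , y₂) ∈ cells P →
      y₁ ≤ y → y ≤ y₂ → (x , y) ∈ cells P)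

IsRow : Polyomino → ℤ → Set
IsRow P y = ∃[ x ] ((x , y) ∈ cells P)

IsL : Polyomino → ℤ → ℤ → Set
IsL P y l = ((l , y) ∈ cells P) × (∀ x → (x , y) ∈ cells P → l ≤ x)

IsR : Polyomino → ℤ → ℤ → Set
IsR P y r = ((r , y) ∈ cells P) × (∀ x → (x , y) ∈ cells P → x ≤ r)

RowIncl : Polyomino → ℤ → ℤ → Set
RowIncl P s t = ∀ ls rs lt rt → IsL P s ls → IsR P s rs → IsL P t lt → IsR P t rt →
  (lt ≤ ls) × (rs ≤ rt)

NEShift : Polyomino → ℤ → ℤ → Set
NEShift P s t = ∀ ls rs lt rt → IsL P s ls → IsR P s rs → IsL P t lt → IsR P t rt →
  (ls < lt) × (rs < rt)

-- NW-paths, encoded by the starting cell and the list of unit steps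
data Dir : Set where
  N W : Dir

move : Dir → Cell → Cell
move N (x , y) = (x , y + 1ℤ)
move W (x , y) = (x - 1ℤ , y)

InSet : CellSet → Cell → List Dir → Set
InSet S a []       = a ∈ S
InSet S a (d ∷ ds) = (a ∈ S) × InSet S (move d a) ds

endpoint : Cell → List Dir → Cell
endpoint a []       = a
endpoint a (d ∷ ds) = endpoint (move d a) ds

sameDir : Dir → Dir → ℕ
sameDir N N = 0
sameDir W W = 0
sameDir N W = 1
sameDir W N = 1

changes : List Dir → ℕ
changes []           = 0
changes (d ∷ [])     = 0
changes (d ∷ e ∷ ds) = sameDir d e Data.Nat.+ changes (e ∷ ds)

NWPath : Polyomino → Cell → Cell → List Dir → Set
NWPath P a b ds = InSet (cells P) a ds × (endpoint a ds ≡ b)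

NWReach : Polyomino → Cell → Cell → Set
NWReach P a b = ∃[ ds ] NWPath P a b ds

DNW≤ : Polyomino → Cell → Cell → ℕ → Set
DNW≤ P a b k = ∃[ ds ] (NWPath P a b ds × (changes ds ≤ℕ k))

DNWP≤ : Polyomino → ℕ → Set
DNWP≤ P k = ∀ a b → NWReach P a b → DNW≤ P a b k

Ascending : Polyomino → Set
Ascending P = Convex P × DNWP≤ P 1

-- Both directions go through one observation: for cells a ↖ b of a convex polyomino,
-- D_NW(a,b) ≤ 1 exactly when one of the two corners (x_a , y_b), (x_b , y_a) of the
-- rectangle spanned by a and b lies in P (row and column convexity then supply the two
-- straight legs of the path). If a row r₂ above r₁ were shifted strictly north-west of it,
-- neither corner of the rectangle from the right end of r₁ to the left end of r₂ lies in P,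
-- although, P being convex and connected, a NW-path joins them. Conversely, each of the
-- three admissible relative positions of the rows of a and b puts a corner inside a row.

module Submission where

open import Defs
open import Data.Integer using (_<_)
open import Data.Sum using (_⊎_)
open import Function.Bundles using (_⇔_; mk⇔)

open import Data.Nat as ℕ using (zero; suc)
import Data.Nat.Properties as ℕ
open import Data.Integer using (ℤ; +_; 1ℤ; -1ℤ; _+_; _-_; ∣_∣; _≤_; _≤?_; _<?_; _≟_)
import Data.Integer.Properties as ℤ
open import Data.Integer.Tactic.RingSolver using (solve-∀)
open import Data.Product using (_×_; _,_; proj₁; proj₂; ∃; ∃-syntax; ∃₂)
open import Data.Sum using (inj₁; inj₂)
open import Data.List using (List; []; _∷_; _++_; replicate; map; filter)
import Data.List.Relation.Unary.All as All
open import Data.List.Membership.Propositional using (_∈_)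
open import Data.List.Membership.Propositional.Properties
  using (∈-map⁺; ∈-map⁻; ∈-filter⁺; ∈-filter⁻)
open import Data.List.Extrema ℤ.≤-totalOrder using (min; max; argmin-all; argmax-all; min≤xs; xs≤max)
open import Data.Empty using (⊥-elim)
open import Function using (id)
open import Relation.Binary.PropositionalEquality using (_≡_; refl; sym; trans; cong; subst; subst₂)
open import Relation.Nullary using (¬_; yes; no; _×-dec_)
open import Relation.Unary using (Decidable)

private
  variable
    a c : Cell
    S : CellSet
    x y : ℤ

i≤j⇒∃[k]i+k≡j : ∀ {i j} → i ≤ j → ∃[ k ] i + + k ≡ j
i≤j⇒∃[k]i+k≡j {i} {j} i≤j =
  ∣ j - i ∣ , trans (cong (λ t → i + t) (ℤ.0≤i⇒+∣i∣≡i (ℤ.i≤j⇒0≤j-i i≤j))) (i+[j-i]≡j i j)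
  where
  i+[j-i]≡j : ∀ i j → i + (j - i) ≡ j
  i+[j-i]≡j = solve-∀

i+[1+k]≡[i+1]+k : ∀ i k → i + + suc k ≡ i + 1ℤ + + k
i+[1+k]≡[i+1]+k i k = trans (cong (λ t → i + t) (ℤ.pos-+ 1 k)) (assoc i (+ k))
  where
  assoc : ∀ i j → i + (1ℤ + j) ≡ i + 1ℤ + j
  assoc = solve-∀

i+[1+k]≡j⇒i+k≡j-1 : ∀ i k j → i + + suc k ≡ j → i + + k ≡ j - 1ℤ
i+[1+k]≡j⇒i+k≡j-1 i k j refl = trans (undo i (+ k)) (cong (_- 1ℤ) (sym (i+[1+k]≡[i+1]+k i k)))
  where
  undo : ∀ i j → i + j ≡ i + 1ℤ + j - 1ℤ
  undo = solve-∀

i+1-1≡i : ∀ i → i + 1ℤ - 1ℤ ≡ i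
i+1-1≡i = solve-∀

i≤i+1 : ∀ i → i ≤ i + 1ℤ
i≤i+1 i = ℤ.i≤i+j i 1ℤ

i-1≤i : ∀ i → i - 1ℤ ≤ i
i-1≤i i = ℤ.i-j≤i i 1ℤ

pred[i+1]≡i : ∀ i → -1ℤ + (i + 1ℤ) ≡ i
pred[i+1]≡i = solve-∀

i<i+1 : ∀ i → i < i + 1ℤ
i<i+1 i = ℤ.i≤pred[j]⇒i<j (ℤ.≤-reflexive (sym (pred[i+1]≡i i)))

≤∧i+1≰j⇒≡ : ∀ {i j} → i ≤ j → ¬ (i + 1ℤ ≤ j) → i ≡ j
≤∧i+1≰j⇒≡ {i} {j} i≤j i+1≰j =
  ℤ.≤-antisym i≤j (subst (j ≤_) (pred[i+1]≡i i) (ℤ.i<j⇒i≤pred[j] (ℤ.≰⇒> i+1≰j)))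

≤∧i≰j-1⇒≡ : ∀ {i j} → i ≤ j → ¬ (i ≤ j - 1ℤ) → i ≡ j
≤∧i≰j-1⇒≡ {i} {j} i≤j i≰j-1 =
  ℤ.≤-antisym i≤j (subst (_≤ i) (suc[j-1]≡j j) (ℤ.i<j⇒suc[i]≤j (ℤ.≰⇒> i≰j-1)))
  where
  suc[j-1]≡j : ∀ j → 1ℤ + (j - 1ℤ) ≡ j
  suc[j-1]≡j = solve-∀

extremes-trichotomy : ∀ {L₁ R₁ L₂ R₂} → ¬ (L₂ < L₁ × R₂ < R₁) →
  (L₂ ≤ L₁ × R₁ ≤ R₂) ⊎ (L₁ ≤ L₂ × R₂ ≤ R₁) ⊎ (L₁ < L₂ × R₁ < R₂)
extremes-trichotomy {L₁} {R₁} {L₂} {R₂} no-shift with R₁ <? R₂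
... | yes R₁<R₂ with L₂ ≤? L₁
...   | yes L₂≤L₁ = inj₁ (L₂≤L₁ , ℤ.<⇒≤ R₁<R₂)
...   | no  L₂≰L₁ = inj₂ (inj₂ (ℤ.≰⇒> L₂≰L₁ , R₁<R₂))
extremes-trichotomy {L₁} {R₁} {L₂} {R₂} no-shift | no R₁≮R₂ with L₁ ≤? L₂
...   | yes L₁≤L₂ = inj₂ (inj₁ (L₁≤L₂ , ℤ.≮⇒≥ R₁≮R₂))
...   | no  L₁≰L₂ with R₁ ≤? R₂
...     | yes R₁≤R₂ = inj₁ (ℤ.<⇒≤ (ℤ.≰⇒> L₁≰L₂) , R₁≤R₂)
...     | no  R₁≰R₂ = ⊥-elim (no-shift (ℤ.≰⇒> L₁≰L₂ , ℤ.≰⇒> R₁≰R₂))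

endpoint-northwest : ∀ a ds → proj₁ (endpoint a ds) ≤ proj₁ a × proj₂ a ≤ proj₂ (endpoint a ds)
endpoint-northwest (x , y) []       = ℤ.≤-refl , ℤ.≤-refl
endpoint-northwest (x , y) (N ∷ ds) with endpoint-northwest (x , y + 1ℤ) ds
... | x′≤x , y+1≤y′ = x′≤x , ℤ.≤-trans (i≤i+1 y) y+1≤y′
endpoint-northwest (x , y) (W ∷ ds) with endpoint-northwest (x - 1ℤ , y) ds
... | x′≤x-1 , y≤y′ = ℤ.≤-trans x′≤x-1 (i-1≤i x) , y≤y′

changes-replicate : ∀ d k → changes (replicate k d) ≡ 0
changes-replicate d zero          = refl
changes-replicate d (suc zero)    = refl
changes-replicate N (suc (suc k)) = changes-replicate N (suc k)
changes-replicate W (suc (suc k)) = changes-replicate W (suc k)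

sameDir≤1 : ∀ d e → sameDir d e ℕ.≤ 1
sameDir≤1 N N = ℕ.z≤n
sameDir≤1 N W = ℕ.≤-refl
sameDir≤1 W N = ℕ.≤-refl
sameDir≤1 W W = ℕ.z≤n

changes-replicate-++-replicate : ∀ d e i j → changes (replicate i d ++ replicate j e) ℕ.≤ 1
changes-replicate-++-replicate d e zero j =
  ℕ.≤-trans (ℕ.≤-reflexive (changes-replicate e j)) ℕ.z≤n
changes-replicate-++-replicate d e (suc zero) zero = ℕ.z≤n
changes-replicate-++-replicate d e (suc zero) (suc j)
  rewrite changes-replicate e (suc j) | ℕ.+-identityʳ (sameDir d e) = sameDir≤1 d e
changes-replicate-++-replicate N e (suc (suc i)) j = changes-replicate-++-replicate N e (suc i) j
changes-replicate-++-replicate W e (suc (suc i)) j = changes-replicate-++-replicate W e (suc i) j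

changes-W∷≡0⇒same-row : ∀ c ds → changes (W ∷ ds) ≡ 0 → proj₂ (endpoint c (W ∷ ds)) ≡ proj₂ c
changes-W∷≡0⇒same-row (x , y) []       _ = refl
changes-W∷≡0⇒same-row (x , y) (W ∷ ds) h = changes-W∷≡0⇒same-row (x - 1ℤ , y) ds h

changes-N∷≡0⇒same-column : ∀ c ds → changes (N ∷ ds) ≡ 0 → proj₁ (endpoint c (N ∷ ds)) ≡ proj₁ c
changes-N∷≡0⇒same-column (x , y) []       _ = refl
changes-N∷≡0⇒same-column (x , y) (N ∷ ds) h = changes-N∷≡0⇒same-column (x , y + 1ℤ) ds h

1+n≤1⇒n≡0 : ∀ {n} → suc n ℕ.≤ 1 → n ≡ 0
1+n≤1⇒n≡0 (ℕ.s≤s n≤0) = ℕ.n≤0⇒n≡0 n≤0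

north-first⇒corner-∈ : ∀ x y ds → InSet S (x , y) (N ∷ ds) → changes (N ∷ ds) ℕ.≤ 1 →
  (x , proj₂ (endpoint (x , y) (N ∷ ds))) ∈ S
north-first⇒corner-∈ x y []       inside _  = proj₂ inside
north-first⇒corner-∈ x y (N ∷ ds) inside ch = north-first⇒corner-∈ x (y + 1ℤ) ds (proj₂ inside) ch
north-first⇒corner-∈ {S} x y (W ∷ ds) inside ch =
  subst (λ t → (x , t) ∈ S) (sym (changes-W∷≡0⇒same-row (x , y + 1ℤ) ds (1+n≤1⇒n≡0 ch)))
    (proj₁ (proj₂ inside))

west-first⇒corner-∈ : ∀ x y ds → InSet S (x , y) (W ∷ ds) → changes (W ∷ ds) ℕ.≤ 1 →
  (proj₁ (endpoint (x , y) (W ∷ ds)) , y) ∈ S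
west-first⇒corner-∈ x y []       inside _  = proj₂ inside
west-first⇒corner-∈ x y (W ∷ ds) inside ch = west-first⇒corner-∈ (x - 1ℤ) y ds (proj₂ inside) ch
west-first⇒corner-∈ {S} x y (N ∷ ds) inside ch =
  subst (λ t → (t , y) ∈ S) (sym (changes-N∷≡0⇒same-column (x - 1ℤ , y) ds (1+n≤1⇒n≡0 ch)))
    (proj₁ (proj₂ inside))

crossing-edge : ∀ {A : Cell → Set} → Decidable A → Connected S a c → a ∈ S → A a → ¬ A c →
  ∃₂ λ u v → Adjacent u v × u ∈ S × v ∈ S × A u × ¬ A v
crossing-edge A? here a∈ Aa ¬Ac = ⊥-elim (¬Ac Aa)
crossing-edge A? (step {a} {b} adj b∈ rest) a∈ Aa ¬Ac with A? b
... | yes Ab = crossing-edge A? rest b∈ Ab ¬Ac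
... | no ¬Ab = a , b , adj , a∈ , b∈ , Aa , ¬Ab

abscissas : ℤ → CellSet → List ℤ
abscissas y S = map proj₁ (filter (λ c → proj₂ c ≟ y) S)

∈-abscissas⁺ : (x , y) ∈ S → x ∈ abscissas y S
∈-abscissas⁺ {y = y} x∈ = ∈-map⁺ proj₁ (∈-filter⁺ (λ c → proj₂ c ≟ y) x∈ refl)

∈-abscissas⁻ : x ∈ abscissas y S → (x , y) ∈ S
∈-abscissas⁻ {y = y} x∈ with ∈-map⁻ proj₁ x∈
... | _ , c∈ , refl with ∈-filter⁻ (λ c → proj₂ c ≟ y) c∈
...   | c∈S , refl = c∈S

module _ (P : Polyomino) where

  RowConvex : Set
  RowConvex = ∀ x₁ x₂ x y → (x₁ , y) ∈ cells P → (x₂ , y) ∈ cells P →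
    x₁ ≤ x → x ≤ x₂ → (x , y) ∈ cells P

  ColumnConvex : Set
  ColumnConvex = ∀ x y₁ y₂ y → (x , y₁) ∈ cells P → (x , y₂) ∈ cells P →
    y₁ ≤ y → y ≤ y₂ → (x , y) ∈ cells P

  Corner : Cell → Cell → Set
  Corner (xa , ya) (xb , yb) = (xa , yb) ∈ cells P ⊎ (xb , ya) ∈ cells P

  RowsOrdered : Set
  RowsOrdered = ∀ r₁ r₂ → IsRow P r₁ → IsRow P r₂ → r₁ < r₂ →
    RowIncl P r₁ r₂ ⊎ RowIncl P r₂ r₁ ⊎ NEShift P r₁ r₂

  NWPath-source : ∀ {a b} ds → NWPath P a b ds → a ∈ cells P
  NWPath-source []      (a∈ , _)       = a∈
  NWPath-source (_ ∷ _) ((a∈ , _) , _) = a∈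

  NWPath-target : ∀ {a b} ds → NWPath P a b ds → b ∈ cells P
  NWPath-target []       (a∈ , refl)       = a∈
  NWPath-target (_ ∷ ds) ((_ , rest) , e) = NWPath-target ds (rest , e)

  NWPath-++ : ∀ {a b c} ds {es} → NWPath P a b ds → NWPath P b c es → NWPath P a c (ds ++ es)
  NWPath-++ []       (_ , refl) q = q
  NWPath-++ (_ ∷ ds) ((a∈ , rest) , e) q with NWPath-++ ds (rest , e) q
  ... | rest′ , e′ = (a∈ , rest′) , e′

  NWReach-trans : ∀ {a b c} → NWReach P a b → NWReach P b c → NWReach P a c
  NWReach-trans (ds , p) (es , q) = ds ++ es , NWPath-++ ds p q

  NWReach-north : ∀ {x y} → (x , y) ∈ cells P → (x , y + 1ℤ) ∈ cells P →
    NWReach P (x , y) (x , y + 1ℤ)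
  NWReach-north lower upper = N ∷ [] , (lower , upper) , refl

  NWReach⇒northwest : ∀ {xa ya xb yb} → NWReach P (xa , ya) (xb , yb) →
    xb ≤ xa × ya ≤ yb × (xa , ya) ∈ cells P × (xb , yb) ∈ cells P
  NWReach⇒northwest {xa} {ya} (ds , path@(_ , refl)) =
    proj₁ bounds , proj₂ bounds , NWPath-source ds path , NWPath-target ds path
    where
    bounds : proj₁ (endpoint (xa , ya) ds) ≤ xa × ya ≤ proj₂ (endpoint (xa , ya) ds)
    bounds = endpoint-northwest (xa , ya) ds

  north-segment : ColumnConvex → ∀ k {x y z} → y + + k ≡ z →
    (x , y) ∈ cells P → (x , z) ∈ cells P → NWPath P (x , y) (x , z) (replicate k N)
  north-segment _ zero {x} {y} refl start _ = start , cong (x ,_) (sym (ℤ.+-identityʳ y))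
  north-segment colC (suc k) {x} {y} {z} refl start end = (start , proj₁ rest) , proj₂ rest
    where
    y+1+k≡z : y + 1ℤ + + k ≡ z
    y+1+k≡z = sym (i+[1+k]≡[i+1]+k y k)
    rest : NWPath P (x , y + 1ℤ) (x , z) (replicate k N)
    rest = north-segment colC k y+1+k≡z
      (colC x y z (y + 1ℤ) start end (i≤i+1 y) (subst (y + 1ℤ ≤_) y+1+k≡z (ℤ.i≤i+j _ (+ k))))
      end

  west-segment : RowConvex → ∀ k {x y z} → z + + k ≡ x →
    (x , y) ∈ cells P → (z , y) ∈ cells P → NWPath P (x , y) (z , y) (replicate k W)
  west-segment _ zero {y = y} {z} refl start _ = start , cong (_, y) (ℤ.+-identityʳ z)
  west-segment rowC (suc k) {x} {y} {z} z+1+k≡x start end = (start , proj₁ rest) , proj₂ rest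
    where
    z+k≡x-1 : z + + k ≡ x - 1ℤ
    z+k≡x-1 = i+[1+k]≡j⇒i+k≡j-1 z k x z+1+k≡x
    rest : NWPath P (x - 1ℤ , y) (z , y) (replicate k W)
    rest = west-segment rowC k z+k≡x-1
      (rowC z x (x - 1ℤ) y end start (subst (z ≤_) z+k≡x-1 (ℤ.i≤i+j z (+ k))) (i-1≤i x))
      end

  vertical-path : ColumnConvex → ∀ {x y₁ y₂} → y₁ ≤ y₂ →
    (x , y₁) ∈ cells P → (x , y₂) ∈ cells P → ∃[ k ] NWPath P (x , y₁) (x , y₂) (replicate k N)
  vertical-path colC y₁≤y₂ start end with i≤j⇒∃[k]i+k≡j y₁≤y₂
  ... | k , e = k , north-segment colC k e start end

  horizontal-path : RowConvex → ∀ {x₁ x₂ y} → x₁ ≤ x₂ →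
    (x₂ , y) ∈ cells P → (x₁ , y) ∈ cells P → ∃[ k ] NWPath P (x₂ , y) (x₁ , y) (replicate k W)
  horizontal-path rowC x₁≤x₂ start end with i≤j⇒∃[k]i+k≡j x₁≤x₂
  ... | k , e = k , west-segment rowC k e start end

  corner⇒DNW≤1 : Convex P → ∀ {a b} → NWReach P a b → Corner a b → DNW≤ P a b 1
  corner⇒DNW≤1 (rowC , colC) a↖b corner with NWReach⇒northwest a↖b | corner
  ... | xb≤xa , ya≤yb , a∈ , b∈ | inj₁ up
    with vertical-path colC ya≤yb a∈ up | horizontal-path rowC xb≤xa up b∈
  ...   | i , climb | j , sweep =
    replicate i N ++ replicate j W , NWPath-++ (replicate i N) climb sweep ,
    changes-replicate-++-replicate N W i j
  corner⇒DNW≤1 (rowC , colC) a↖b corner | xb≤xa , ya≤yb , a∈ , b∈ | inj₂ left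
    with horizontal-path rowC xb≤xa a∈ left | vertical-path colC ya≤yb left b∈
  ...   | j , sweep | i , climb =
    replicate j W ++ replicate i N , NWPath-++ (replicate j W) sweep climb ,
    changes-replicate-++-replicate W N j i

  DNW≤1⇒corner : ∀ {a b} → DNW≤ P a b 1 → Corner a b
  DNW≤1⇒corner ([] , (a∈ , refl) , _) = inj₁ a∈
  DNW≤1⇒corner {xa , ya} (N ∷ ds , (inside , refl) , ch) = inj₁ (north-first⇒corner-∈ xa ya ds inside ch)
  DNW≤1⇒corner {xa , ya} (W ∷ ds , (inside , refl) , ch) = inj₂ (west-first⇒corner-∈ xa ya ds inside ch)

  -- Walking from q to p inside P, the first step leaving the quadrant north-west of (xp , y + 1)
  -- goes east out of column xp or south into row y; either way P has a cell in row y directly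
  -- below one in row y + 1, at some abscissa ≤ xp.
  vertical-edge-west-of : ColumnConvex → ∀ {xp y xq yq} →
    (xp , y) ∈ cells P → (xq , yq) ∈ cells P → xq ≤ xp → y + 1ℤ ≤ yq →
    ∃[ x ] (x ≤ xp × (x , y) ∈ cells P × (x , y + 1ℤ) ∈ cells P)
  vertical-edge-west-of colC {xp} {y} p∈ q∈ xq≤xp y+1≤yq
    with crossing-edge A? (connected P q∈ p∈) q∈ (y+1≤yq , xq≤xp) (λ (y+1≤y , _) → ℤ.<⇒≱ (i<i+1 y) y+1≤y)
    where
    A : Cell → Set
    A (x , z) = y + 1ℤ ≤ z × x ≤ xp
    A? : Decidable A
    A? (x , z) = (y + 1ℤ ≤? z) ×-dec (x ≤? xp)
  ... | _ , _ , east x z , u∈ , _ , (y+1≤z , x≤xp) , ¬Av =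
    xp , ℤ.≤-refl , p∈ ,
    colC xp y z (y + 1ℤ) p∈ (subst (λ t → (t , z) ∈ cells P) x≡xp u∈) (i≤i+1 y) y+1≤z
    where
    x≡xp : x ≡ xp
    x≡xp = ≤∧i+1≰j⇒≡ x≤xp (λ x+1≤xp → ¬Av (y+1≤z , x+1≤xp))
  ... | _ , _ , west x z , _ , _ , (y+1≤z , x≤xp) , ¬Av =
    ⊥-elim (¬Av (y+1≤z , ℤ.≤-trans (i-1≤i x) x≤xp))
  ... | _ , _ , north x z , _ , _ , (y+1≤z , x≤xp) , ¬Av =
    ⊥-elim (¬Av (ℤ.≤-trans y+1≤z (i≤i+1 z) , x≤xp))
  ... | _ , _ , south x z , u∈ , v∈ , (y+1≤z , x≤xp) , ¬Av =
    x , x≤xp ,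
    subst (λ t → (x , t) ∈ cells P) (trans (cong (_- 1ℤ) (sym y+1≡z)) (i+1-1≡i y)) v∈ ,
    subst (λ t → (x , t) ∈ cells P) (sym y+1≡z) u∈
    where
    y+1≡z : y + 1ℤ ≡ z
    y+1≡z = ≤∧i≰j-1⇒≡ y+1≤z (λ y+1≤z-1 → ¬Av (y+1≤z-1 , x≤xp))

  vertical-edge-between : Convex P → ∀ {xp y xq yq} →
    (xp , y) ∈ cells P → (xq , yq) ∈ cells P → xq ≤ xp → y + 1ℤ ≤ yq →
    ∃[ x ] (xq ≤ x × x ≤ xp × (x , y) ∈ cells P × (x , y + 1ℤ) ∈ cells P)
  vertical-edge-between (rowC , colC) {xp} {y} {xq} {yq} p∈ q∈ xq≤xp y+1≤yq
    with vertical-edge-west-of colC p∈ q∈ xq≤xp y+1≤yq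
  ... | x , x≤xp , lower , upper with xq ≤? x
  ...   | yes xq≤x = x , xq≤x , x≤xp , lower , upper
  ...   | no  xq≰x = xq , ℤ.≤-refl , xq≤xp , lower′ ,
                     colC xq y yq (y + 1ℤ) lower′ q∈ (i≤i+1 y) y+1≤yq
    where
    lower′ : (xq , y) ∈ cells P
    lower′ = rowC x xp xq y lower p∈ (ℤ.<⇒≤ (ℤ.≰⇒> xq≰x)) xq≤xp

  nw-reachable-+ : Convex P → ∀ k {xp y xq yq} → y + + k ≡ yq →
    (xp , y) ∈ cells P → (xq , yq) ∈ cells P → xq ≤ xp → NWReach P (xp , y) (xq , yq)
  nw-reachable-+ (rowC , _) zero {y = y} e p∈ q∈ xq≤xp with trans (sym (ℤ.+-identityʳ y)) e
  ... | refl with horizontal-path rowC xq≤xp p∈ q∈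
  ...   | k , path = replicate k W , path
  nw-reachable-+ cv (suc k) {xp} {y} {xq} {yq} e p∈ q∈ xq≤xp
    with trans (sym (i+[1+k]≡[i+1]+k y k)) e
  ... | y+1+k≡yq
    with vertical-edge-between cv p∈ q∈ xq≤xp (subst (y + 1ℤ ≤_) y+1+k≡yq (ℤ.i≤i+j _ (+ k)))
  ...   | x , xq≤x , x≤xp , lower , upper with horizontal-path (proj₁ cv) x≤xp p∈ lower
  ...     | j , sweep =
    NWReach-trans (replicate j W , sweep) (NWReach-trans (NWReach-north lower upper)
      (nw-reachable-+ cv k y+1+k≡yq upper q∈ xq≤x))

  nw-reachable : Convex P → ∀ {xp yp xq yq} → xq ≤ xp → yp ≤ yq →
    (xp , yp) ∈ cells P → (xq , yq) ∈ cells P → NWReach P (xp , yp) (xq , yq)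
  nw-reachable cv xq≤xp yp≤yq p∈ q∈ with i≤j⇒∃[k]i+k≡j yp≤yq
  ... | k , e = nw-reachable-+ cv k e p∈ q∈ xq≤xp

  leftmost : ∀ {y} → IsRow P y → ∃ (IsL P y)
  leftmost {y} (x , x∈) =
    min x xs ,
    argmin-all id {P = λ l → (l , y) ∈ cells P} x∈ (All.tabulate ∈-abscissas⁻) ,
    λ x′ x′∈ → All.lookup (min≤xs x xs) (∈-abscissas⁺ x′∈)
    where
    xs : List ℤ
    xs = abscissas y (cells P)

  rightmost : ∀ {y} → IsRow P y → ∃ (IsR P y)
  rightmost {y} (x , x∈) =
    max x xs ,
    argmax-all id {P = λ r → (r , y) ∈ cells P} x∈ (All.tabulate ∈-abscissas⁻) ,
    λ x′ x′∈ → All.lookup (xs≤max x xs) (∈-abscissas⁺ x′∈)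
    where
    xs : List ℤ
    xs = abscissas y (cells P)

  IsL-unique : ∀ {y l l′} → IsL P y l → IsL P y l′ → l ≡ l′
  IsL-unique (l∈ , l≤) (l′∈ , l′≤) = ℤ.≤-antisym (l≤ _ l′∈) (l′≤ _ l∈)

  IsR-unique : ∀ {y r r′} → IsR P y r → IsR P y r′ → r ≡ r′
  IsR-unique (r∈ , ≤r) (r′∈ , ≤r′) = ℤ.≤-antisym (≤r′ _ r∈) (≤r _ r′∈)

  RowIncl-intro : ∀ {s t Ls Rs Lt Rt} → IsL P s Ls → IsR P s Rs → IsL P t Lt → IsR P t Rt →
    Lt ≤ Ls → Rs ≤ Rt → RowIncl P s t
  RowIncl-intro hLs hRs hLt hRt Lt≤Ls Rs≤Rt _ _ _ _ hLs′ hRs′ hLt′ hRt′ =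
    subst₂ _≤_ (IsL-unique hLt hLt′) (IsL-unique hLs hLs′) Lt≤Ls ,
    subst₂ _≤_ (IsR-unique hRs hRs′) (IsR-unique hRt hRt′) Rs≤Rt

  NEShift-intro : ∀ {s t Ls Rs Lt Rt} → IsL P s Ls → IsR P s Rs → IsL P t Lt → IsR P t Rt →
    Ls < Lt → Rs < Rt → NEShift P s t
  NEShift-intro hLs hRs hLt hRt Ls<Lt Rs<Rt _ _ _ _ hLs′ hRs′ hLt′ hRt′ =
    subst₂ _<_ (IsL-unique hLs hLs′) (IsL-unique hLt hLt′) Ls<Lt ,
    subst₂ _<_ (IsR-unique hRs hRs′) (IsR-unique hRt hRt′) Rs<Rt

  ascending⇒no-northwest-shift : Convex P → DNWP≤ P 1 → ∀ {r₁ r₂ L₁ R₁ L₂ R₂} → r₁ < r₂ →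
    IsL P r₁ L₁ → IsR P r₁ R₁ → IsL P r₂ L₂ → IsR P r₂ R₂ → ¬ (L₂ < L₁ × R₂ < R₁)
  ascending⇒no-northwest-shift cv asc {R₁ = R₁} {L₂ = L₂} r₁<r₂
    (_ , L₁≤) (R₁∈ , _) (L₂∈ , L₂≤) (_ , ≤R₂) (L₂<L₁ , R₂<R₁)
    with DNW≤1⇒corner (asc _ _ (nw-reachable cv L₂≤R₁ (ℤ.<⇒≤ r₁<r₂) R₁∈ L₂∈))
    where
    L₂≤R₁ : L₂ ≤ R₁
    L₂≤R₁ = ℤ.≤-trans (L₂≤ _ L₂∈) (ℤ.≤-trans (≤R₂ _ L₂∈) (ℤ.<⇒≤ R₂<R₁))
  ... | inj₁ R₁r₂∈ = ℤ.<⇒≱ R₂<R₁ (≤R₂ _ R₁r₂∈)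
  ... | inj₂ L₂r₁∈ = ℤ.<⇒≱ L₂<L₁ (L₁≤ _ L₂r₁∈)

  ascending⇒rows-ordered : Convex P → DNWP≤ P 1 → RowsOrdered
  ascending⇒rows-ordered cv asc r₁ r₂ row₁ row₂ r₁<r₂
    with leftmost row₁ | rightmost row₁ | leftmost row₂ | rightmost row₂
  ... | L₁ , hL₁ | R₁ , hR₁ | L₂ , hL₂ | R₂ , hR₂
    with extremes-trichotomy (ascending⇒no-northwest-shift cv asc r₁<r₂ hL₁ hR₁ hL₂ hR₂)
  ...   | inj₁ (L₂≤L₁ , R₁≤R₂)        = inj₁ (RowIncl-intro hL₁ hR₁ hL₂ hR₂ L₂≤L₁ R₁≤R₂)
  ...   | inj₂ (inj₁ (L₁≤L₂ , R₂≤R₁)) = inj₂ (inj₁ (RowIncl-intro hL₂ hR₂ hL₁ hR₁ L₁≤L₂ R₂≤R₁))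
  ...   | inj₂ (inj₂ (L₁<L₂ , R₁<R₂)) = inj₂ (inj₂ (NEShift-intro hL₁ hR₁ hL₂ hR₂ L₁<L₂ R₁<R₂))

  row-between : RowConvex → ∀ {x y l r} → IsL P y l → IsR P y r → l ≤ x → x ≤ r → (x , y) ∈ cells P
  row-between rowC (l∈ , _) (r∈ , _) = rowC _ _ _ _ l∈ r∈

  rows-ordered⇒corner : RowConvex → RowsOrdered → ∀ {a b} → NWReach P a b → Corner a b
  rows-ordered⇒corner rowC ord {xa , ya} {xb , yb} a↖b with NWReach⇒northwest a↖b
  ... | xb≤xa , ya≤yb , a∈ , b∈ with ya <? yb
  ...   | no ya≮yb = inj₁ (subst (λ t → (xa , t) ∈ cells P) (ℤ.≤∧≮⇒≡ ya≤yb ya≮yb) a∈)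
  ...   | yes ya<yb with leftmost (xa , a∈) | rightmost (xa , a∈) | leftmost (xb , b∈) | rightmost (xb , b∈)
  ...     | La , hLa | Ra , hRa | Lb , hLb | Rb , hRb with ord ya yb (xa , a∈) (xb , b∈) ya<yb
  ...       | inj₁ incl with incl La Ra Lb Rb hLa hRa hLb hRb
  ...         | Lb≤La , Ra≤Rb = inj₁ (row-between rowC hLb hRb
                  (ℤ.≤-trans Lb≤La (proj₂ hLa xa a∈)) (ℤ.≤-trans (proj₂ hRa xa a∈) Ra≤Rb))
  rows-ordered⇒corner rowC ord {xa , ya} {xb , yb} a↖b | xb≤xa , ya≤yb , a∈ , b∈ | yes ya<yb
    | La , hLa | Ra , hRa | Lb , hLb | Rb , hRb | inj₂ (inj₁ incl) with incl Lb Rb La Ra hLb hRb hLa hRa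
  ...         | La≤Lb , _ = inj₂ (row-between rowC hLa hRa
                  (ℤ.≤-trans La≤Lb (proj₂ hLb xb b∈)) (ℤ.≤-trans xb≤xa (proj₂ hRa xa a∈)))
  rows-ordered⇒corner rowC ord {xa , ya} {xb , yb} a↖b | xb≤xa , ya≤yb , a∈ , b∈ | yes ya<yb
    | La , hLa | Ra , hRa | Lb , hLb | Rb , hRb | inj₂ (inj₂ shift) with shift La Ra Lb Rb hLa hRa hLb hRb
  ...         | La<Lb , _ = inj₂ (row-between rowC hLa hRa
                  (ℤ.≤-trans (ℤ.<⇒≤ La<Lb) (proj₂ hLb xb b∈)) (ℤ.≤-trans xb≤xa (proj₂ hRa xa a∈)))

proposition4 : (P : Polyomino) → Convex P →
    Ascending P ⇔
    (∀ r₁ r₂ → IsRow P r₁ → IsRow P r₂ → r₁ < r₂ →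
    RowIncl P r₁ r₂ ⊎ RowIncl P r₂ r₁ ⊎ NEShift P r₁ r₂)
proposition4 P cv = mk⇔
  (λ (_ , asc) → ascending⇒rows-ordered P cv asc)
  (λ ord → cv , λ a b a↖b → corner⇒DNW≤1 P cv a↖b (rows-ordered⇒corner P (proj₁ cv) ord a↖b))
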